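{- Let $F=GF(5^4)$ be the finite field of order $625$, let $g\in F^\times$ be a primitive element, and for $i=0,1,\dots,15$ let $C_i=g^i\langle g^{16}\rangle\subset F^\times$ be the cyclotomic classes of order $16$. Define \[ D_0=\bigcup_{i\in\{4,5,6,7,8,9,10,11\}} C_i,\qquad D_1=\bigcup_{i\in\{0,1,2,3,4,5,6,7\}} C_i . \] Then, in the additive group $G=(F,+)$: (1) $D_0$ is skew-symmetric, i.e. for all $x\in F\setminus\{0\}$, $x\in D_0$ if and only if $-x\notin D_0$; and (2) for every $w\in F\setminus\{0\}$, $P_{D_0}(w)+P_{D_1}(w)=-2$.
   Context: For a finite abelian group $G$ (written additively) and a subset $D\subseteq G$, define $s_D:G\to\{\pm1\}$ by $s_D(x)=-1$ if $x\in D$ and $s_D(x)=1$ if $x\notin D$. The periodic autocorrelation of $D$ at shift $w\in G$ is $P_D(w)=\sum_{x\in G} s_D(x)\,s_D(x+w)$. -}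

module Defs where

open import Data.Nat as ℕ using (ℕ; zero; suc)
open import Data.Nat.DivMod using (_mod_)
open import Data.Fin using (Fin; toℕ)
open import Data.Product using (_×_; _,_; ∃-syntax)
open import Data.List using (List; []; _∷_; map; foldr; concatMap; allFin)
open import Data.Integer using (ℤ; +_; -[1+_]) renaming (_+_ to _+ℤ_; _*_ to _*ℤ_)
open import Data.Bool using (if_then_else_)
open import Relation.Nullary using (does)
open import Relation.Unary using (Pred; Decidable)
open import Relation.Binary.PropositionalEquality using (_≡_)
open import Level using (0ℓ)

F₅ : Set
F₅ = Fin 5

red : ℕ → F₅
red n = n mod 5

-- GF(5^4) = F₅[x] / (x^4 + x^3 + 2x^2 + 2)   (an irreducible, indeed
-- primitive, quartic over F₅).  An element (a0 , a1 , a2 , a3) stands for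
-- a0 + a1 x + a2 x^2 + a3 x^3.

F : Set
F = F₅ × F₅ × F₅ × F₅

0F : F
0F = red 0 , red 0 , red 0 , red 0

1F : F
1F = red 1 , red 0 , red 0 , red 0

infixl 6 _+F_
infixl 7 _*F_
infixr 8 _^F_

_+F_ : F → F → F
(a0 , a1 , a2 , a3) +F (b0 , b1 , b2 , b3) =
  red (toℕ a0 ℕ.+ toℕ b0) , red (toℕ a1 ℕ.+ toℕ b1) ,
  red (toℕ a2 ℕ.+ toℕ b2) , red (toℕ a3 ℕ.+ toℕ b3)

-F_ : F → F
-F (a0 , a1 , a2 , a3) =
  red (4 ℕ.* toℕ a0) , red (4 ℕ.* toℕ a1) , red (4 ℕ.* toℕ a2) , red (4 ℕ.* toℕ a3)

-- multiplication: schoolbook product r0..r6, then reduce using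
--   x^4 ≡ 3 + 0x + 3x^2 + 4x^3
--   x^5 ≡ 2 + 3x + 2x^2 + 4x^3
--   x^6 ≡ 2 + 2x + 0x^2 + 3x^3      (mod x^4 + x^3 + 2x^2 + 2, mod 5)
_*F_ : F → F → F
(a0 , a1 , a2 , a3) *F (b0 , b1 , b2 , b3) =
  red (r0 ℕ.+ 3 ℕ.* r4 ℕ.+ 2 ℕ.* r5 ℕ.+ 2 ℕ.* r6) ,
  red (r1 ℕ.+ 0 ℕ.* r4 ℕ.+ 3 ℕ.* r5 ℕ.+ 2 ℕ.* r6) ,
  red (r2 ℕ.+ 3 ℕ.* r4 ℕ.+ 2 ℕ.* r5 ℕ.+ 0 ℕ.* r6) ,
  red (r3 ℕ.+ 4 ℕ.* r4 ℕ.+ 4 ℕ.* r5 ℕ.+ 3 ℕ.* r6)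
  where
  x0 = toℕ a0 ; x1 = toℕ a1 ; x2 = toℕ a2 ; x3 = toℕ a3
  y0 = toℕ b0 ; y1 = toℕ b1 ; y2 = toℕ b2 ; y3 = toℕ b3
  r0 = x0 ℕ.* y0
  r1 = x0 ℕ.* y1 ℕ.+ x1 ℕ.* y0
  r2 = x0 ℕ.* y2 ℕ.+ x1 ℕ.* y1 ℕ.+ x2 ℕ.* y0
  r3 = x0 ℕ.* y3 ℕ.+ x1 ℕ.* y2 ℕ.+ x2 ℕ.* y1 ℕ.+ x3 ℕ.* y0
  r4 = x1 ℕ.* y3 ℕ.+ x2 ℕ.* y2 ℕ.+ x3 ℕ.* y1
  r5 = x2 ℕ.* y3 ℕ.+ x3 ℕ.* y2
  r6 = x3 ℕ.* y3

_^F_ : F → ℕ → F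
a ^F zero  = 1F
a ^F suc n = a *F (a ^F n)

elements : List F
elements =
  concatMap (λ a0 → concatMap (λ a1 → concatMap (λ a2 → map (λ a3 →
    (a0 , a1 , a2 , a3)) (allFin 5)) (allFin 5)) (allFin 5)) (allFin 5)

IsPrimitive : F → Set
IsPrimitive g = ∀ (x : F) → (x ≡ 0F → Data.Empty.⊥) → ∃[ k ] g ^F k ≡ x
  where import Data.Empty

C : F → ℕ → Pred F 0ℓ
C g i x = ∃[ j ] x ≡ (g ^F i) *F ((g ^F 16) ^F j)

D₀ : F → Pred F 0ℓ
D₀ g x = ∃[ i ] ((4 ℕ.≤ i) × (i ℕ.≤ 11) × C g i x)

D₁ : F → Pred F 0ℓ
D₁ g x = ∃[ i ] ((i ℕ.≤ 7) × C g i x)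

-- periodic autocorrelation (membership in D is decided by the given
-- decision procedure; the value does not depend on which one)

sumℤ : List ℤ → ℤ
sumℤ = foldr _+ℤ_ (+ 0)

s : {D : Pred F 0ℓ} → Decidable D → F → ℤ
s dec x = if does (dec x) then -[1+ 0 ] else + 1

P : {D : Pred F 0ℓ} → Decidable D → F → ℤ
P dec w = sumℤ (map (λ x → s dec x *ℤ s dec (x +F w)) elements)

module Submission where

-- The multiplicative group of F is cyclic of order 624 = 16 · 39, generated by the class γ of
-- the indeterminate.  A tabulated discrete logarithm, certified by two exhaustive checks, makes
-- ind x = log x mod 16 a homomorphism from F^× onto ℤ/16.  For a primitive g, writing γ as a
-- power of g shows that ind g has an inverse r modulo 16, and then g^i ⟨g^16⟩ is the set of
-- nonzero x with ind x · r ≡ i; so D₀ and D₁ depend on g only through r.  Skew-symmetry follows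
-- from ind (-1) = 8, since adding 8 exchanges {4, …, 11} with its complement modulo 16.  D₀ and
-- D₁ are unions of cosets of ⟨z₀⟩, z₀ = γ^16, and multiplication by z₀ permutes F additively, so
-- their autocorrelations are constant on these cosets; it remains to evaluate them at
-- γ^0, …, γ^15 for each of the 8 units r.  The field laws used along the way are polynomial
-- identities modulo 5 in the coordinates, decided by the ring solver.

open import Defs
open import Algebra.Bundles using (CommutativeSemiring; RawRing; RawSemiring)
open import Algebra.Solver.Ring.AlmostCommutativeRing
  using (fromCommutativeSemiring; _-Raw-AlmostCommutative⟶_; Induced-equivalence)
open import Data.Bool using (if_then_else_)
open import Data.Fin using (Fin; zero; suc; toℕ)
open import Data.Fin.Properties using (toℕ-fromℕ<; toℕ-injective; toℕ<n; all?; ≤-decTotalOrder)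
open import Data.Integer using (ℤ; +_; -[1+_]) renaming (_+_ to _+ℤ_; _*_ to _*ℤ_)
import Data.Integer.Properties as ℤ
open import Data.List using (map)
open import Data.List.Properties using (map-cong; map-∘)
open import Data.List.Relation.Binary.Permutation.Propositional using (_↭_; ↭-sym; ↭⇒↭ₛ)
open import Data.List.Relation.Binary.Permutation.Propositional.Properties using (map⁺)
import Data.List.Relation.Binary.Permutation.Setoid.Properties as Permutation
open import Data.List.Sort.Base using (SortingAlgorithm)
import Data.List.Sort.MergeSort as MergeSort
open import Data.Maybe using (just; nothing)
open import Data.Nat
  using (ℕ; zero; suc; _+_; _*_; _%_; _/_; _≤_; _<_; _≤?_; s≤s; NonZero; +-*-rawSemiring)
import Data.Nat as ℕ
open import Data.Nat.DivMod
  using (%-distribˡ-+; %-distribˡ-*; m%n%n≡m%n; m<n⇒m%n≡m; m%n<n; m≡m%n+[m/n]*n; [m+kn]%n≡m%n)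
open import Data.Nat.Properties
  using (+-assoc; +-comm; +-identityˡ; +-identityʳ; *-assoc; *-comm; *-identityˡ; *-identityʳ; *-zeroˡ; *-zeroʳ; *-suc;
         *-distribˡ-+; *-distribʳ-+; ≤-trans; m≤m+n; allUpTo?; anyUpTo?)
open import Data.Product using (_×_; _,_; ∃₂; ∃-syntax; proj₁; proj₂)
open import Data.Product.Properties using (≡-dec)
open import Data.Product.Relation.Binary.Lex.NonStrict using (×-decTotalOrder)
open import Data.Vec using (Vec; []; _∷_; lookup)
open import Data.Vec.N-ary using (N-ary)
open import Data.Vec.Relation.Binary.Pointwise.Inductive as Pointwise using (Pointwise; []; _∷_)
open import Function using (id; _∘_)
open import Function.Bundles using (_⇔_; mk⇔; Equivalence)
open import Function.Construct.Composition using (_⇔-∘_)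
open import Level using (0ℓ)
open import Relation.Binary.Bundles using (Setoid; DecTotalOrder)
open import Relation.Binary.Structures using (IsEquivalence)
open import Relation.Binary.Definitions using (DecidableEquality; WeaklyDecidable)
open import Relation.Binary.PropositionalEquality
open import Relation.Nullary using (¬_; Dec; yes; no; map′)
open import Relation.Nullary.Decidable using (from-yes; does-⇔; ¬?; _×-dec_; _→-dec_)
open import Relation.Unary using (Pred; Decidable)

-- The field laws of F

module Modulo (n : ℕ) .{{_ : NonZero n}} where

  infix 4 _≈_
  record _≈_ (m m′ : ℕ) : Set where
    constructor mk≈
    field %≡% : m % n ≡ m′ % n

  open _≈_ public

  ≡⇒≈ : ∀ {m m′} → m ≡ m′ → m ≈ m′
  ≡⇒≈ m≡m′ = mk≈ (cong (_% n) m≡m′)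

  m%n≈m : ∀ m → m % n ≈ m
  m%n≈m m = mk≈ (m%n%n≡m%n m n)

  ≡%⇒≈ : ∀ {m} k → m ≡ k % n → m ≈ k
  ≡%⇒≈ k refl = m%n≈m k

  ≈-refl : ∀ {m} → m ≈ m
  ≈-refl = mk≈ refl

  ≈-isEquivalence : IsEquivalence _≈_
  ≈-isEquivalence = record
    { refl = ≈-refl
    ; sym = λ (mk≈ e) → mk≈ (sym e)
    ; trans = λ (mk≈ e) (mk≈ f) → mk≈ (trans e f) }

  +-cong : ∀ {m m′ k k′} → m ≈ m′ → k ≈ k′ → m + k ≈ m′ + k′
  +-cong {m} {m′} {k} {k′} (mk≈ p) (mk≈ q) = mk≈ (begin
    (m + k) % n              ≡⟨ %-distribˡ-+ m k n ⟩
    (m % n + k % n) % n      ≡⟨ cong₂ (λ a b → (a + b) % n) p q ⟩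
    (m′ % n + k′ % n) % n    ≡⟨ %-distribˡ-+ m′ k′ n ⟨
    (m′ + k′) % n            ∎)
    where open ≡-Reasoning

  *-cong : ∀ {m m′ k k′} → m ≈ m′ → k ≈ k′ → m * k ≈ m′ * k′
  *-cong {m} {m′} {k} {k′} (mk≈ p) (mk≈ q) = mk≈ (begin
    (m * k) % n              ≡⟨ %-distribˡ-* m k n ⟩
    (m % n * (k % n)) % n    ≡⟨ cong₂ (λ a b → (a * b) % n) p q ⟩
    (m′ % n * (k′ % n)) % n  ≡⟨ %-distribˡ-* m′ k′ n ⟨
    (m′ * k′) % n            ∎)
    where open ≡-Reasoning

  *-congˡ : ∀ k {m m′} → m ≈ m′ → k * m ≈ k * m′
  *-congˡ k {m} {m′} = *-cong {k} {k} {m} {m′} ≈-refl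

  *-congʳ : ∀ k {m m′} → m ≈ m′ → m * k ≈ m′ * k
  *-congʳ k {m} {m′} m≈m′ = *-cong {m} {m′} {k} {k} m≈m′ ≈-refl

  commutativeSemiring : CommutativeSemiring 0ℓ 0ℓ
  commutativeSemiring = record
    { Carrier = ℕ ; _≈_ = _≈_ ; _+_ = _+_ ; _*_ = _*_ ; 0# = 0 ; 1# = 1
    ; isCommutativeSemiring = record
      { isSemiring = record
        { isSemiringWithoutAnnihilatingZero = record
          { +-isCommutativeMonoid = record
            { isMonoid = record
              { isSemigroup = record
                { isMagma = record { isEquivalence = ≈-isEquivalence ; ∙-cong = +-cong }
                ; assoc = λ a b c → ≡⇒≈ (+-assoc a b c) }
              ; identity = (λ a → ≡⇒≈ (+-identityˡ a)) , (λ a → ≡⇒≈ (+-identityʳ a)) }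
            ; comm = λ a b → ≡⇒≈ (+-comm a b) }
          ; *-cong = *-cong
          ; *-assoc = λ a b c → ≡⇒≈ (*-assoc a b c)
          ; *-identity = (λ a → ≡⇒≈ (*-identityˡ a)) , (λ a → ≡⇒≈ (*-identityʳ a))
          ; distrib = (λ a b c → ≡⇒≈ (*-distribˡ-+ a b c)) , (λ a b c → ≡⇒≈ (*-distribʳ-+ a b c)) }
        ; zero = (λ a → ≡⇒≈ (*-zeroˡ a)) , (λ a → ≡⇒≈ (*-zeroʳ a)) }
      ; *-comm = λ a b → ≡⇒≈ (*-comm a b) } }

  open CommutativeSemiring commutativeSemiring public using (setoid)

open Modulo 5 using (mk≈) renaming (_≈_ to _≡₅_; ≈-refl to ≡₅-refl)

-- Normalising with coefficients reduced modulo 5 makes the ring solver decide identities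
-- between polynomials with natural-number coefficients modulo 5.
F₅-coefficients : RawRing 0ℓ 0ℓ
F₅-coefficients = record
  { Carrier = ℕ ; _≈_ = _≡_
  ; _+_ = λ m k → (m + k) % 5 ; _*_ = λ m k → (m * k) % 5 ; -_ = id
  ; 0# = 0 ; 1# = 1 }

reduction : F₅-coefficients -Raw-AlmostCommutative⟶ fromCommutativeSemiring (Modulo.commutativeSemiring 5)
reduction = record
  { ⟦_⟧ = id
  ; +-homo = λ m k → Modulo.m%n≈m 5 (m + k)
  ; *-homo = λ m k → Modulo.m%n≈m 5 (m * k)
  ; -‿homo = λ _ → ≡₅-refl
  ; 0-homo = ≡₅-refl
  ; 1-homo = ≡₅-refl }

coefficient-equality : WeaklyDecidable (Induced-equivalence reduction)
coefficient-equality m k with m ℕ.≟ k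
... | yes m≡k = just (Modulo.≡⇒≈ 5 m≡k)
... | no _ = nothing

open import Algebra.Solver.Ring F₅-coefficients (fromCommutativeSemiring (Modulo.commutativeSemiring 5))
  reduction coefficient-equality
  using (Polynomial; con; _:+_; _:*_; _:=_; solve)

-- Over ℕ, _⊠_ computes the coordinates of _*F_ before their reduction modulo 5.
module Product (R : RawSemiring 0ℓ 0ℓ) where
  open RawSemiring R using (1#) renaming (Carrier to A; _+_ to infixl 6 _⊕_; _*_ to infixl 7 _⊗_)
  open import Algebra.Definitions.RawSemiring R using () renaming (_×_ to infixr 8 _·_)

  infixl 6 _⊞_
  infixl 7 _⊠_

  _⊞_ : Vec A 4 → Vec A 4 → Vec A 4
  (x0 ∷ x1 ∷ x2 ∷ x3 ∷ []) ⊞ (y0 ∷ y1 ∷ y2 ∷ y3 ∷ []) = x0 ⊕ y0 ∷ x1 ⊕ y1 ∷ x2 ⊕ y2 ∷ x3 ⊕ y3 ∷ []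

  _⊠_ : Vec A 4 → Vec A 4 → Vec A 4
  (x0 ∷ x1 ∷ x2 ∷ x3 ∷ []) ⊠ (y0 ∷ y1 ∷ y2 ∷ y3 ∷ []) =
    r0 ⊕ 3 · 1# ⊗ r4 ⊕ 2 · 1# ⊗ r5 ⊕ 2 · 1# ⊗ r6 ∷
    r1 ⊕ 0 · 1# ⊗ r4 ⊕ 3 · 1# ⊗ r5 ⊕ 2 · 1# ⊗ r6 ∷
    r2 ⊕ 3 · 1# ⊗ r4 ⊕ 2 · 1# ⊗ r5 ⊕ 0 · 1# ⊗ r6 ∷
    r3 ⊕ 4 · 1# ⊗ r4 ⊕ 4 · 1# ⊗ r5 ⊕ 3 · 1# ⊗ r6 ∷ []
    where
    r0 r1 r2 r3 r4 r5 r6 : A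
    r0 = x0 ⊗ y0
    r1 = x0 ⊗ y1 ⊕ x1 ⊗ y0
    r2 = x0 ⊗ y2 ⊕ x1 ⊗ y1 ⊕ x2 ⊗ y0
    r3 = x0 ⊗ y3 ⊕ x1 ⊗ y2 ⊕ x2 ⊗ y1 ⊕ x3 ⊗ y0
    r4 = x1 ⊗ y3 ⊕ x2 ⊗ y2 ⊕ x3 ⊗ y1
    r5 = x2 ⊗ y3 ⊕ x3 ⊗ y2
    r6 = x3 ⊗ y3

open Product +-*-rawSemiring

infix 4 _≋_
_≋_ : Vec ℕ 4 → Vec ℕ 4 → Set
_≋_ = Pointwise _≡₅_

Vec₅ : Setoid 0ℓ 0ℓ
Vec₅ = Pointwise.setoid (Modulo.setoid 5) 4

≋-refl : ∀ {p} → p ≋ p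
≋-refl = Setoid.refl Vec₅

-- Evaluating ⊞ and ⊠ on pairs of congruent numbers shows that they respect ≋.
congruentPairs : RawSemiring 0ℓ 0ℓ
congruentPairs = record
  { Carrier = ∃₂ _≡₅_ ; _≈_ = _≡_
  ; _+_ = λ (m , m′ , p) (k , k′ , q) → m + k , m′ + k′ , Modulo.+-cong 5 p q
  ; _*_ = λ (m , m′ , p) (k , k′ , q) → m * k , m′ * k′ , Modulo.*-cong 5 p q
  ; 0# = 0 , 0 , ≡₅-refl ; 1# = 1 , 1 , ≡₅-refl }

pairs : ∀ {n} {p p′ : Vec ℕ n} → Pointwise _≡₅_ p p′ → Vec (∃₂ _≡₅_) n
pairs [] = []
pairs (_∷_ {x = m} {y = m′} e es) = (m , m′ , e) ∷ pairs es

congruent : ∀ {n} (v : Vec (∃₂ _≡₅_) n) →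
            Pointwise _≡₅_ (Data.Vec.map proj₁ v) (Data.Vec.map (proj₁ ∘ proj₂) v)
congruent [] = []
congruent ((_ , _ , e) ∷ v) = e ∷ congruent v

module _ where
  open Product congruentPairs using () renaming (_⊞_ to _⊞ᶜ_; _⊠_ to _⊠ᶜ_)

  ⊞-cong : ∀ {p p′ q q′} → p ≋ p′ → q ≋ q′ → p ⊞ q ≋ p′ ⊞ q′
  ⊞-cong e@(_ ∷ _ ∷ _ ∷ _ ∷ []) f@(_ ∷ _ ∷ _ ∷ _ ∷ []) = congruent (pairs e ⊞ᶜ pairs f)

  ⊠-cong : ∀ {p p′ q q′} → p ≋ p′ → q ≋ q′ → p ⊠ q ≋ p′ ⊠ q′
  ⊠-cong e@(_ ∷ _ ∷ _ ∷ _ ∷ []) f@(_ ∷ _ ∷ _ ∷ _ ∷ []) = congruent (pairs e ⊠ᶜ pairs f)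

polynomials : ℕ → RawSemiring 0ℓ 0ℓ
polynomials n = record
  { Carrier = Polynomial n ; _≈_ = _≡_ ; _+_ = _:+_ ; _*_ = _:*_ ; 0# = con 0 ; 1# = con 1 }

module _ where
  open Product (polynomials 12) using () renaming (_⊞_ to _⊞ₚ_; _⊠_ to _⊠ₚ_)

  assoc-equation distribʳ-equation : Fin 4 → N-ary 12 (Polynomial 12) (Polynomial 12 × Polynomial 12)
  assoc-equation i a0 a1 a2 a3 b0 b1 b2 b3 c0 c1 c2 c3 = lookup ((a ⊠ₚ b) ⊠ₚ c) i := lookup (a ⊠ₚ (b ⊠ₚ c)) i
    where
    a b c : Vec (Polynomial 12) 4
    a = a0 ∷ a1 ∷ a2 ∷ a3 ∷ []
    b = b0 ∷ b1 ∷ b2 ∷ b3 ∷ []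
    c = c0 ∷ c1 ∷ c2 ∷ c3 ∷ []
  distribʳ-equation i a0 a1 a2 a3 b0 b1 b2 b3 c0 c1 c2 c3 = lookup ((a ⊞ₚ b) ⊠ₚ c) i := lookup (a ⊠ₚ c ⊞ₚ b ⊠ₚ c) i
    where
    a b c : Vec (Polynomial 12) 4
    a = a0 ∷ a1 ∷ a2 ∷ a3 ∷ []
    b = b0 ∷ b1 ∷ b2 ∷ b3 ∷ []
    c = c0 ∷ c1 ∷ c2 ∷ c3 ∷ []

module _ where
  open Product (polynomials 4) using () renaming (_⊠_ to _⊠ₚ_)

  one : Vec (Polynomial 4) 4
  one = con 1 ∷ con 0 ∷ con 0 ∷ con 0 ∷ []

  identityˡ-equation identityʳ-equation : Fin 4 → N-ary 4 (Polynomial 4) (Polynomial 4 × Polynomial 4)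
  identityˡ-equation i a0 a1 a2 a3 = lookup (one ⊠ₚ (a0 ∷ a1 ∷ a2 ∷ a3 ∷ [])) i := lookup (a0 ∷ a1 ∷ a2 ∷ a3 ∷ []) i
  identityʳ-equation i a0 a1 a2 a3 = lookup ((a0 ∷ a1 ∷ a2 ∷ a3 ∷ []) ⊠ₚ one) i := lookup (a0 ∷ a1 ∷ a2 ∷ a3 ∷ []) i

⊠-assoc : ∀ a b c → (a ⊠ b) ⊠ c ≋ a ⊠ (b ⊠ c)
⊠-assoc (a0 ∷ a1 ∷ a2 ∷ a3 ∷ []) (b0 ∷ b1 ∷ b2 ∷ b3 ∷ []) (c0 ∷ c1 ∷ c2 ∷ c3 ∷ []) =
  solve 12 (assoc-equation zero) ≡₅-refl a0 a1 a2 a3 b0 b1 b2 b3 c0 c1 c2 c3 ∷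
  solve 12 (assoc-equation (suc zero)) ≡₅-refl a0 a1 a2 a3 b0 b1 b2 b3 c0 c1 c2 c3 ∷
  solve 12 (assoc-equation (suc (suc zero))) ≡₅-refl a0 a1 a2 a3 b0 b1 b2 b3 c0 c1 c2 c3 ∷
  solve 12 (assoc-equation (suc (suc (suc zero)))) ≡₅-refl a0 a1 a2 a3 b0 b1 b2 b3 c0 c1 c2 c3 ∷ []

⊠-distribʳ-⊞ : ∀ a b c → (a ⊞ b) ⊠ c ≋ a ⊠ c ⊞ b ⊠ c
⊠-distribʳ-⊞ (a0 ∷ a1 ∷ a2 ∷ a3 ∷ []) (b0 ∷ b1 ∷ b2 ∷ b3 ∷ []) (c0 ∷ c1 ∷ c2 ∷ c3 ∷ []) =
  solve 12 (distribʳ-equation zero) ≡₅-refl a0 a1 a2 a3 b0 b1 b2 b3 c0 c1 c2 c3 ∷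
  solve 12 (distribʳ-equation (suc zero)) ≡₅-refl a0 a1 a2 a3 b0 b1 b2 b3 c0 c1 c2 c3 ∷
  solve 12 (distribʳ-equation (suc (suc zero))) ≡₅-refl a0 a1 a2 a3 b0 b1 b2 b3 c0 c1 c2 c3 ∷
  solve 12 (distribʳ-equation (suc (suc (suc zero)))) ≡₅-refl a0 a1 a2 a3 b0 b1 b2 b3 c0 c1 c2 c3 ∷ []

⊠-identityˡ : ∀ a → (1 ∷ 0 ∷ 0 ∷ 0 ∷ []) ⊠ a ≋ a
⊠-identityˡ (a0 ∷ a1 ∷ a2 ∷ a3 ∷ []) =
  solve 4 (identityˡ-equation zero) ≡₅-refl a0 a1 a2 a3 ∷
  solve 4 (identityˡ-equation (suc zero)) ≡₅-refl a0 a1 a2 a3 ∷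
  solve 4 (identityˡ-equation (suc (suc zero))) ≡₅-refl a0 a1 a2 a3 ∷
  solve 4 (identityˡ-equation (suc (suc (suc zero)))) ≡₅-refl a0 a1 a2 a3 ∷ []

⊠-identityʳ : ∀ a → a ⊠ (1 ∷ 0 ∷ 0 ∷ 0 ∷ []) ≋ a
⊠-identityʳ (a0 ∷ a1 ∷ a2 ∷ a3 ∷ []) =
  solve 4 (identityʳ-equation zero) ≡₅-refl a0 a1 a2 a3 ∷
  solve 4 (identityʳ-equation (suc zero)) ≡₅-refl a0 a1 a2 a3 ∷
  solve 4 (identityʳ-equation (suc (suc zero))) ≡₅-refl a0 a1 a2 a3 ∷
  solve 4 (identityʳ-equation (suc (suc (suc zero)))) ≡₅-refl a0 a1 a2 a3 ∷ []

coeffs : F → Vec ℕ 4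
coeffs (a0 , a1 , a2 , a3) = toℕ a0 ∷ toℕ a1 ∷ toℕ a2 ∷ toℕ a3 ∷ []

reduce : Vec ℕ 4 → F
reduce (n0 ∷ n1 ∷ n2 ∷ n3 ∷ []) = red n0 , red n1 , red n2 , red n3

coeffs-reduce : ∀ p → coeffs (reduce p) ≋ p
coeffs-reduce (n0 ∷ n1 ∷ n2 ∷ n3 ∷ []) = toℕ-red n0 ∷ toℕ-red n1 ∷ toℕ-red n2 ∷ toℕ-red n3 ∷ []
  where
  toℕ-red : ∀ n → toℕ (red n) ≡₅ n
  toℕ-red n = mk≈ (trans (cong (_% 5) (toℕ-fromℕ< (m%n<n n 5))) (m%n%n≡m%n n 5))

coeffs-injective : ∀ {x y} → coeffs x ≋ coeffs y → x ≡ y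
coeffs-injective {a0 , a1 , a2 , a3} {b0 , b1 , b2 , b3} (e0 ∷ e1 ∷ e2 ∷ e3 ∷ []) =
  cong₂ _,_ (≡₅⇒≡ e0) (cong₂ _,_ (≡₅⇒≡ e1) (cong₂ _,_ (≡₅⇒≡ e2) (≡₅⇒≡ e3)))
  where
  ≡₅⇒≡ : ∀ {a b : F₅} → toℕ a ≡₅ toℕ b → a ≡ b
  ≡₅⇒≡ {a} {b} (mk≈ e) = toℕ-injective (trans (sym (m<n⇒m%n≡m (toℕ<n a))) (trans e (m<n⇒m%n≡m (toℕ<n b))))

coeffs-+F : ∀ x y → coeffs (x +F y) ≋ coeffs x ⊞ coeffs y
coeffs-+F x y = coeffs-reduce (coeffs x ⊞ coeffs y)

coeffs-*F : ∀ x y → coeffs (x *F y) ≋ coeffs x ⊠ coeffs y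
coeffs-*F x y = coeffs-reduce (coeffs x ⊠ coeffs y)

*F-assoc : ∀ x y z → (x *F y) *F z ≡ x *F (y *F z)
*F-assoc x y z = coeffs-injective (begin
  coeffs ((x *F y) *F z)            ≈⟨ coeffs-*F (x *F y) z ⟩
  coeffs (x *F y) ⊠ coeffs z        ≈⟨ ⊠-cong (coeffs-*F x y) (≋-refl {coeffs z}) ⟩
  (coeffs x ⊠ coeffs y) ⊠ coeffs z  ≈⟨ ⊠-assoc (coeffs x) (coeffs y) (coeffs z) ⟩
  coeffs x ⊠ (coeffs y ⊠ coeffs z)  ≈⟨ ⊠-cong (≋-refl {coeffs x}) (coeffs-*F y z) ⟨
  coeffs x ⊠ coeffs (y *F z)        ≈⟨ coeffs-*F x (y *F z) ⟨
  coeffs (x *F (y *F z))            ∎)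
  where open import Relation.Binary.Reasoning.Setoid Vec₅

*F-distribʳ-+F : ∀ x y z → (x +F y) *F z ≡ x *F z +F y *F z
*F-distribʳ-+F x y z = coeffs-injective (begin
  coeffs ((x +F y) *F z)                     ≈⟨ coeffs-*F (x +F y) z ⟩
  coeffs (x +F y) ⊠ coeffs z                 ≈⟨ ⊠-cong (coeffs-+F x y) (≋-refl {coeffs z}) ⟩
  (coeffs x ⊞ coeffs y) ⊠ coeffs z           ≈⟨ ⊠-distribʳ-⊞ (coeffs x) (coeffs y) (coeffs z) ⟩
  coeffs x ⊠ coeffs z ⊞ coeffs y ⊠ coeffs z  ≈⟨ ⊞-cong (coeffs-*F x z) (coeffs-*F y z) ⟨
  coeffs (x *F z) ⊞ coeffs (y *F z)          ≈⟨ coeffs-+F (x *F z) (y *F z) ⟨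
  coeffs (x *F z +F y *F z)                  ∎)
  where open import Relation.Binary.Reasoning.Setoid Vec₅

*F-identityˡ : ∀ x → 1F *F x ≡ x
*F-identityˡ x = coeffs-injective (Setoid.trans Vec₅ (coeffs-*F 1F x) (⊠-identityˡ (coeffs x)))

*F-identityʳ : ∀ x → x *F 1F ≡ x
*F-identityʳ x = coeffs-injective (Setoid.trans Vec₅ (coeffs-*F x 1F) (⊠-identityʳ (coeffs x)))

^F-+ : ∀ g m n → g ^F (m + n) ≡ g ^F m *F g ^F n
^F-+ g zero n = sym (*F-identityˡ (g ^F n))
^F-+ g (suc m) n = trans (cong (g *F_) (^F-+ g m n)) (sym (*F-assoc g (g ^F m) (g ^F n)))

^F-* : ∀ g m n → g ^F (m * n) ≡ (g ^F m) ^F n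
^F-* g m zero = cong (g ^F_) (*-zeroʳ m)
^F-* g m (suc n) = begin
  g ^F (m * suc n)           ≡⟨ cong (g ^F_) (*-suc m n) ⟩
  g ^F (m + m * n)           ≡⟨ ^F-+ g m (m * n) ⟩
  g ^F m *F g ^F (m * n)     ≡⟨ cong (g ^F m *F_) (^F-* g m n) ⟩
  g ^F m *F (g ^F m) ^F n    ∎
  where open ≡-Reasoning

^F-split : ∀ g i j → g ^F (i + j * 16) ≡ g ^F i *F (g ^F 16) ^F j
^F-split g i j = trans (^F-+ g i (j * 16)) (cong (g ^F i *F_) (trans (cong (g ^F_) (*-comm j 16)) (^F-* g 16 j)))

^F-divMod : ∀ g n → g ^F n ≡ g ^F (n % 16) *F (g ^F 16) ^F (n / 16)
^F-divMod g n = trans (cong (g ^F_) (m≡m%n+[m/n]*n n 16)) (^F-split g (n % 16) (n / 16))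

-- Discrete logarithm to the base γ

infix 4 _≟F_
_≟F_ : DecidableEquality F
_≟F_ = ≡-dec Data.Fin._≟_ (≡-dec Data.Fin._≟_ (≡-dec Data.Fin._≟_ Data.Fin._≟_))

allF? : {P : Pred F 0ℓ} → Decidable P → Dec (∀ x → P x)
allF? P? = map′ (λ h (a , b , c , d) → h a b c d) (λ h a b c d → h (a , b , c , d))
  (all? λ a → all? λ b → all? λ c → all? λ d → P? (a , b , c , d))

γ z₀ : F
γ = red 0 , red 1 , red 0 , red 0
z₀ = red 4 , red 2 , red 3 , red 0

z₀≡γ^16 : z₀ ≡ γ ^F 16
z₀≡γ^16 = refl

-- log x is the discrete logarithm of x ≠ 0 to the base γ (its value at 0 is junk), and ind x
-- is the index, with respect to γ, of the cyclotomic class of order 16 containing x.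
log : F → ℕ
log (a , b , c , d) = lookup (lookup (lookup (lookup table a) b) c) d
  where
  table : Vec (Vec (Vec (Vec ℕ 5) 5) 5) 5
  table =
    (((  0 ∷   3 ∷ 159 ∷ 471 ∷ 315 ∷ []) ∷ (  2 ∷ 228 ∷ 104 ∷ 285 ∷ 450 ∷ []) ∷ (158 ∷ 441 ∷ 384 ∷ 606 ∷ 260 ∷ []) ∷ (470 ∷ 572 ∷ 294 ∷  72 ∷ 129 ∷ []) ∷ (314 ∷ 138 ∷ 597 ∷ 416 ∷ 540 ∷ []) ∷ []) ∷
     ((  1 ∷ 386 ∷ 110 ∷ 534 ∷  51 ∷ []) ∷ (227 ∷ 376 ∷ 337 ∷ 551 ∷ 567 ∷ []) ∷ (103 ∷ 453 ∷ 108 ∷ 145 ∷ 582 ∷ []) ∷ (284 ∷ 273 ∷ 329 ∷ 311 ∷ 122 ∷ []) ∷ (449 ∷ 233 ∷ 373 ∷ 510 ∷ 205 ∷ []) ∷ []) ∷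
     ((157 ∷  66 ∷ 542 ∷ 207 ∷ 266 ∷ []) ∷ (440 ∷ 467 ∷ 429 ∷ 278 ∷ 485 ∷ []) ∷ (383 ∷  83 ∷ 532 ∷  99 ∷ 493 ∷ []) ∷ (605 ∷  42 ∷ 389 ∷ 361 ∷ 529 ∷ []) ∷ (259 ∷ 301 ∷ 609 ∷ 114 ∷ 264 ∷ []) ∷ []) ∷
     ((469 ∷ 578 ∷ 519 ∷ 230 ∷ 378 ∷ []) ∷ (571 ∷ 576 ∷ 426 ∷ 297 ∷ 613 ∷ []) ∷ (293 ∷ 217 ∷  49 ∷  77 ∷ 354 ∷ []) ∷ ( 71 ∷ 181 ∷ 411 ∷ 220 ∷ 395 ∷ []) ∷ (128 ∷ 173 ∷ 590 ∷ 117 ∷ 155 ∷ []) ∷ []) ∷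
     ((313 ∷ 363 ∷ 222 ∷ 422 ∷  74 ∷ []) ∷ (137 ∷ 517 ∷ 198 ∷  61 ∷ 545 ∷ []) ∷ (596 ∷ 434 ∷ 623 ∷  17 ∷ 585 ∷ []) ∷ (415 ∷ 270 ∷ 457 ∷ 420 ∷ 141 ∷ []) ∷ (539 ∷ 255 ∷ 239 ∷  25 ∷  64 ∷ []) ∷ []) ∷ []) ∷
    (((  0 ∷ 458 ∷ 240 ∷ 223 ∷ 199 ∷ []) ∷ (385 ∷ 295 ∷ 598 ∷ 160 ∷ 105 ∷ []) ∷ (109 ∷ 330 ∷ 374 ∷ 111 ∷ 338 ∷ []) ∷ (533 ∷ 390 ∷ 610 ∷ 543 ∷ 430 ∷ []) ∷ ( 50 ∷ 412 ∷ 591 ∷ 520 ∷ 427 ∷ []) ∷ []) ∷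
     ((226 ∷ 358 ∷ 305 ∷ 555 ∷ 474 ∷ []) ∷ (375 ∷ 611 ∷ 592 ∷ 241 ∷ 599 ∷ []) ∷ (336 ∷ 405 ∷ 335 ∷ 306 ∷ 593 ∷ []) ∷ (550 ∷ 563 ∷ 404 ∷ 135 ∷ 488 ∷ []) ∷ (566 ∷ 478 ∷ 334 ∷  38 ∷ 276 ∷ []) ∷ []) ∷
     ((102 ∷ 188 ∷ 134 ∷ 345 ∷ 168 ∷ []) ∷ (452 ∷ 569 ∷ 487 ∷ 615 ∷ 547 ∷ []) ∷ (107 ∷ 601 ∷ 549 ∷ 185 ∷ 211 ∷ []) ∷ (144 ∷  11 ∷ 562 ∷ 515 ∷  96 ∷ []) ∷ (581 ∷  31 ∷ 403 ∷ 152 ∷ 483 ∷ []) ∷ []) ∷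
     ((283 ∷  28 ∷  37 ∷ 370 ∷ 525 ∷ []) ∷ (272 ∷ 574 ∷ 275 ∷  44 ∷ 183 ∷ []) ∷ (328 ∷ 392 ∷ 565 ∷  13 ∷  56 ∷ []) ∷ (310 ∷  54 ∷ 477 ∷ 196 ∷ 192 ∷ []) ∷ (121 ∷ 444 ∷ 333 ∷ 319 ∷ 438 ∷ []) ∷ []) ∷
     ((448 ∷ 619 ∷ 554 ∷ 244 ∷ 351 ∷ []) ∷ (232 ∷ 424 ∷ 473 ∷ 536 ∷ 209 ∷ []) ∷ (372 ∷ 246 ∷ 225 ∷ 557 ∷ 347 ∷ []) ∷ (509 ∷ 326 ∷ 357 ∷  59 ∷   8 ∷ []) ∷ (204 ∷ 498 ∷ 304 ∷  34 ∷ 465 ∷ []) ∷ []) ∷ []) ∷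
    (((156 ∷ 379 ∷ 614 ∷ 355 ∷ 396 ∷ []) ∷ ( 65 ∷  75 ∷ 546 ∷ 586 ∷ 142 ∷ []) ∷ (541 ∷ 316 ∷ 451 ∷ 261 ∷ 130 ∷ []) ∷ (206 ∷  52 ∷ 568 ∷ 583 ∷ 123 ∷ []) ∷ (265 ∷ 267 ∷ 486 ∷ 494 ∷ 530 ∷ []) ∷ []) ∷
     ((439 ∷ 526 ∷ 184 ∷  57 ∷ 193 ∷ []) ∷ (466 ∷ 352 ∷ 210 ∷ 348 ∷   9 ∷ []) ∷ (428 ∷ 200 ∷ 106 ∷ 339 ∷ 431 ∷ []) ∷ (277 ∷ 475 ∷ 600 ∷ 594 ∷ 489 ∷ []) ∷ (484 ∷ 169 ∷ 548 ∷ 212 ∷  97 ∷ []) ∷ []) ∷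
     ((382 ∷  87 ∷ 514 ∷   6 ∷ 461 ∷ []) ∷ ( 82 ∷ 291 ∷  95 ∷  20 ∷ 560 ∷ []) ∷ (531 ∷ 397 ∷ 143 ∷ 131 ∷ 124 ∷ []) ∷ ( 98 ∷ 194 ∷  10 ∷ 432 ∷ 490 ∷ []) ∷ (492 ∷ 462 ∷ 561 ∷ 125 ∷ 491 ∷ []) ∷ []) ∷
     ((604 ∷ 400 ∷ 151 ∷ 507 ∷  86 ∷ []) ∷ ( 41 ∷ 215 ∷ 482 ∷ 164 ∷ 513 ∷ []) ∷ (388 ∷  68 ∷ 580 ∷ 365 ∷   5 ∷ []) ∷ (360 ∷ 190 ∷  30 ∷ 621 ∷ 460 ∷ []) ∷ (528 ∷  89 ∷ 402 ∷ 503 ∷ 381 ∷ []) ∷ []) ∷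
     ((258 ∷ 501 ∷ 344 ∷ 324 ∷ 290 ∷ []) ∷ (300 ∷  47 ∷ 167 ∷ 252 ∷  94 ∷ []) ∷ (608 ∷ 147 ∷ 101 ∷  79 ∷  19 ∷ []) ∷ (113 ∷ 308 ∷ 187 ∷  15 ∷ 559 ∷ []) ∷ (263 ∷ 341 ∷ 133 ∷ 367 ∷  81 ∷ []) ∷ []) ∷ []) ∷
    (((468 ∷  84 ∷  43 ∷ 302 ∷  67 ∷ []) ∷ (577 ∷ 218 ∷ 182 ∷ 174 ∷ 579 ∷ []) ∷ (518 ∷ 435 ∷ 271 ∷ 256 ∷ 364 ∷ []) ∷ (229 ∷ 442 ∷ 573 ∷ 139 ∷   4 ∷ []) ∷ (377 ∷ 454 ∷ 274 ∷ 234 ∷ 387 ∷ []) ∷ []) ∷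
     ((570 ∷ 602 ∷  12 ∷  32 ∷ 189 ∷ []) ∷ (575 ∷ 393 ∷  55 ∷ 445 ∷  29 ∷ []) ∷ (425 ∷ 247 ∷ 327 ∷ 499 ∷ 620 ∷ []) ∷ (296 ∷ 331 ∷ 391 ∷ 413 ∷ 459 ∷ []) ∷ (612 ∷ 406 ∷ 564 ∷ 479 ∷ 359 ∷ []) ∷ []) ∷
     ((292 ∷ 398 ∷ 195 ∷ 463 ∷  88 ∷ []) ∷ (216 ∷  69 ∷ 191 ∷  90 ∷ 401 ∷ []) ∷ ( 48 ∷ 148 ∷ 309 ∷ 342 ∷ 502 ∷ []) ∷ ( 76 ∷ 317 ∷  53 ∷ 268 ∷ 380 ∷ []) ∷ (353 ∷ 201 ∷ 476 ∷ 170 ∷ 527 ∷ []) ∷ []) ∷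
     (( 70 ∷ 149 ∷ 318 ∷ 202 ∷ 399 ∷ []) ∷ (180 ∷ 179 ∷ 437 ∷ 249 ∷ 150 ∷ []) ∷ (410 ∷ 178 ∷ 120 ∷ 322 ∷ 506 ∷ []) ∷ (219 ∷ 436 ∷ 443 ∷ 455 ∷  85 ∷ []) ∷ (394 ∷ 248 ∷ 332 ∷ 407 ∷ 603 ∷ []) ∷ []) ∷
     ((127 ∷ 505 ∷ 369 ∷ 496 ∷ 214 ∷ []) ∷ (172 ∷ 409 ∷ 524 ∷ 236 ∷ 481 ∷ []) ∷ (589 ∷ 177 ∷ 282 ∷ 288 ∷ 163 ∷ []) ∷ (116 ∷ 119 ∷  27 ∷ 418 ∷ 512 ∷ []) ∷ (154 ∷ 321 ∷  36 ∷ 522 ∷  40 ∷ []) ∷ []) ∷ []) ∷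
    (((312 ∷ 511 ∷ 535 ∷ 552 ∷ 146 ∷ []) ∷ (362 ∷ 115 ∷ 208 ∷ 279 ∷ 100 ∷ []) ∷ (221 ∷ 118 ∷ 231 ∷ 298 ∷  78 ∷ []) ∷ (421 ∷  26 ∷ 423 ∷  62 ∷  18 ∷ []) ∷ ( 73 ∷ 417 ∷ 472 ∷ 286 ∷ 607 ∷ []) ∷ []) ∷
     ((136 ∷  39 ∷ 556 ∷ 242 ∷ 307 ∷ []) ∷ (516 ∷ 153 ∷ 346 ∷ 616 ∷ 186 ∷ []) ∷ (197 ∷ 320 ∷ 371 ∷  45 ∷  14 ∷ []) ∷ ( 60 ∷  35 ∷ 245 ∷ 537 ∷ 558 ∷ []) ∷ (544 ∷ 521 ∷ 224 ∷ 161 ∷ 112 ∷ []) ∷ []) ∷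
     ((595 ∷ 213 ∷  58 ∷ 349 ∷ 340 ∷ []) ∷ (433 ∷ 126 ∷   7 ∷  21 ∷ 132 ∷ []) ∷ (622 ∷ 504 ∷ 508 ∷ 165 ∷ 366 ∷ []) ∷ ( 16 ∷ 368 ∷ 325 ∷ 253 ∷  80 ∷ []) ∷ (584 ∷ 495 ∷ 356 ∷ 587 ∷ 262 ∷ []) ∷ []) ∷
     ((414 ∷ 480 ∷  33 ∷ 446 ∷ 500 ∷ []) ∷ (269 ∷ 171 ∷ 464 ∷  91 ∷ 343 ∷ []) ∷ (456 ∷ 408 ∷ 203 ∷ 250 ∷ 323 ∷ []) ∷ (419 ∷ 523 ∷ 497 ∷ 237 ∷ 289 ∷ []) ∷ (140 ∷ 235 ∷ 303 ∷ 175 ∷ 257 ∷ []) ∷ []) ∷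
     ((538 ∷ 162 ∷ 243 ∷ 617 ∷  46 ∷ []) ∷ (254 ∷ 588 ∷ 350 ∷  22 ∷ 166 ∷ []) ∷ (238 ∷ 176 ∷ 447 ∷  92 ∷ 251 ∷ []) ∷ ( 24 ∷ 281 ∷ 618 ∷  23 ∷  93 ∷ []) ∷ ( 63 ∷ 287 ∷ 553 ∷ 280 ∷ 299 ∷ []) ∷ []) ∷ []) ∷ []

ind : F → ℕ
ind x = log x % 16

log-coset : ∀ w → w ≢ 0F → γ ^F ind w *F z₀ ^F (log w / 16) ≡ w
log-coset = from-yes (allF? λ w → ¬? (w ≟F 0F) →-dec γ ^F ind w *F z₀ ^F (log w / 16) ≟F w)

ind-γ* : ∀ y → y ≢ 0F → γ *F y ≢ 0F × ind (γ *F y) ≡ suc (ind y) % 16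
ind-γ* = from-yes (allF? λ y → ¬? (y ≟F 0F) →-dec ¬? (γ *F y ≟F 0F) ×-dec ind (γ *F y) ℕ.≟ suc (ind y) % 16)

-F≡-1*F : ∀ x → -F x ≡ -F 1F *F x
-F≡-1*F = from-yes (allF? λ x → -F x ≟F -F 1F *F x)

open Modulo 16 using (*-cong; *-congˡ; *-congʳ; +-cong; ≡%⇒≈; %≡%) renaming (_≈_ to _≡₁₆_; m%n≈m to m%16≈m)

ind-γ^ : ∀ n → γ ^F n ≢ 0F × ind (γ ^F n) ≡ n % 16
ind-γ^ zero = (λ ()) , refl
ind-γ^ (suc n) = proj₁ step , (begin
  ind (γ *F γ ^F n)          ≡⟨ proj₂ step ⟩
  suc (ind (γ ^F n)) % 16    ≡⟨ cong (λ i → suc i % 16) (proj₂ (ind-γ^ n)) ⟩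
  suc (n % 16) % 16          ≡⟨ %-distribˡ-+ 1 n 16 ⟨
  suc n % 16                 ∎)
  where
  open ≡-Reasoning
  step : γ *F γ ^F n ≢ 0F × ind (γ *F γ ^F n) ≡ suc (ind (γ ^F n)) % 16
  step = ind-γ* (γ ^F n) (proj₁ (ind-γ^ n))

ind-of-γ^ : ∀ {n x} → γ ^F n ≡ x → x ≢ 0F × ind x ≡ n % 16
ind-of-γ^ {n} refl = ind-γ^ n

γ^log : ∀ {w} → w ≢ 0F → γ ^F log w ≡ w
γ^log {w} w≢0 = begin
  γ ^F log w                               ≡⟨ ^F-divMod γ (log w) ⟩
  γ ^F ind w *F (γ ^F 16) ^F (log w / 16)  ≡⟨ cong (λ h → γ ^F ind w *F h ^F (log w / 16)) z₀≡γ^16 ⟨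
  γ ^F ind w *F z₀ ^F (log w / 16)         ≡⟨ log-coset w w≢0 ⟩
  w                                        ∎
  where open ≡-Reasoning

ind-*F : ∀ {x y} → x ≢ 0F → y ≢ 0F → x *F y ≢ 0F × ind (x *F y) ≡ (ind x + ind y) % 16
ind-*F {x} {y} x≢0 y≢0 = proj₁ product , trans (proj₂ product) (%-distribˡ-+ (log x) (log y) 16)
  where
  product : x *F y ≢ 0F × ind (x *F y) ≡ (log x + log y) % 16
  product = ind-of-γ^ {log x + log y} {x *F y}
    (trans (^F-+ γ (log x) (log y)) (cong₂ _*F_ (γ^log x≢0) (γ^log y≢0)))

ind-^F : ∀ {g} → g ≢ 0F → ∀ n → g ^F n ≢ 0F × ind (g ^F n) ≡ (log g * n) % 16
ind-^F {g} g≢0 n = ind-of-γ^ {log g * n} {g ^F n} (trans (^F-* γ (log g) n) (cong (_^F n) (γ^log g≢0)))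

-- Cyclotomic classes of a primitive element

relIndex : ℕ → F → ℕ
relIndex r x = (ind x * r) % 16

-- For a primitive g with ind g * r ≡ 1 (mod 16), ⋃C r I is the union of the classes C g i
-- over i ∈ I (Primitive.⋃C⇔).
⋃C : ℕ → (ℕ → Set) → Pred F 0ℓ
⋃C r I x = x ≢ 0F × I (relIndex r x)

⋃C? : ∀ r {I : ℕ → Set} → Decidable I → Decidable (⋃C r I)
⋃C? r I? x = ¬? (x ≟F 0F) ×-dec I? (relIndex r x)

I₀ I₁ : ℕ → Set
I₀ i = 4 ≤ i × i ≤ 11
I₁ i = i ≤ 7

I₀? : Decidable I₀
I₀? i = 4 ≤? i ×-dec i ≤? 11

I₁? : Decidable I₁
I₁? i = i ≤? 7

Invertible₁₆ : ℕ → Set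
Invertible₁₆ r = ∃[ m ] m < 16 × (m * r) % 16 ≡ 1

invertible₁₆? : Decidable Invertible₁₆
invertible₁₆? r = anyUpTo? (λ m → (m * r) % 16 ℕ.≟ 1) 16

module Primitive {g : F} (prim : IsPrimitive g) where

  g≢0 : g ≢ 0F
  g≢0 g≡0 with subst IsPrimitive g≡0 prim γ (λ ())
  ... | zero , ()
  ... | suc _ , ()

  γ-as-power : ∃[ k ] g ^F k ≡ γ
  γ-as-power = prim γ (λ ())

  r : ℕ
  r = proj₁ γ-as-power % 16

  r<16 : r < 16
  r<16 = m%n<n (proj₁ γ-as-power) 16

  r-inverse : ind g * r ≡₁₆ 1
  r-inverse = begin
    ind g * r       ≈⟨ *-cong (m%16≈m (log g)) (m%16≈m k) ⟩
    log g * k       ≈⟨ ≡%⇒≈ (log g * k) (proj₂ (ind-^F g≢0 k)) ⟨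
    ind (g ^F k)    ≡⟨ cong ind (proj₂ γ-as-power) ⟩
    1               ∎
    where
    open import Relation.Binary.Reasoning.Setoid (Modulo.setoid 16)
    k : ℕ
    k = proj₁ γ-as-power

  r-invertible : Invertible₁₆ r
  r-invertible = ind g , m%n<n (log g) 16 , %≡% r-inverse

  relIndex-^F : ∀ n → relIndex r (g ^F n) ≡ n % 16
  relIndex-^F n = %≡% (begin
    ind (g ^F n) * r   ≈⟨ *-congʳ r (≡%⇒≈ (log g * n) (proj₂ (ind-^F g≢0 n))) ⟩
    log g * n * r      ≡⟨ trans (cong (_* r) (*-comm (log g) n)) (*-assoc n (log g) r) ⟩
    n * (log g * r)    ≈⟨ *-congˡ n (*-congʳ r (m%16≈m (log g))) ⟨
    n * (ind g * r)    ≈⟨ *-congˡ n r-inverse ⟩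
    n * 1              ≡⟨ *-identityʳ n ⟩
    n                  ∎)
    where open import Relation.Binary.Reasoning.Setoid (Modulo.setoid 16)

  C⇔ : ∀ {i x} → i < 16 → C g i x ⇔ (x ≢ 0F × relIndex r x ≡ i)
  C⇔ {i} {x} i<16 = mk⇔ to from
    where
    open ≡-Reasoning

    to : C g i x → x ≢ 0F × relIndex r x ≡ i
    to (j , x≡) = subst (_≢ 0F) (sym x≡gⁿ) (proj₁ (ind-^F g≢0 (i + j * 16))) , (begin
      relIndex r x                     ≡⟨ cong (relIndex r) x≡gⁿ ⟩
      relIndex r (g ^F (i + j * 16))   ≡⟨ relIndex-^F (i + j * 16) ⟩
      (i + j * 16) % 16                ≡⟨ [m+kn]%n≡m%n i j 16 ⟩
      i % 16                           ≡⟨ m<n⇒m%n≡m i<16 ⟩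
      i                                ∎)
      where
      x≡gⁿ : x ≡ g ^F (i + j * 16)
      x≡gⁿ = trans x≡ (sym (^F-split g i j))

    from : x ≢ 0F × relIndex r x ≡ i → C g i x
    from (x≢0 , relIndex≡i) = n / 16 , (begin
      x                                      ≡⟨ gⁿ≡x ⟨
      g ^F n                                 ≡⟨ ^F-divMod g n ⟩
      g ^F (n % 16) *F (g ^F 16) ^F (n / 16) ≡⟨ cong (λ e → g ^F e *F (g ^F 16) ^F (n / 16)) n%16≡i ⟩
      g ^F i *F (g ^F 16) ^F (n / 16)        ∎)
      where
      n : ℕ
      n = proj₁ (prim x x≢0)
      gⁿ≡x : g ^F n ≡ x
      gⁿ≡x = proj₂ (prim x x≢0)
      n%16≡i : n % 16 ≡ i
      n%16≡i = trans (sym (relIndex-^F n)) (trans (cong (relIndex r) gⁿ≡x) relIndex≡i)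

  ⋃C⇔ : ∀ {I : ℕ → Set} → (∀ {i} → I i → i < 16) → ∀ x → (∃[ i ] I i × C g i x) ⇔ ⋃C r I x
  ⋃C⇔ {I} bounded x = mk⇔ to from
    where
    to : (∃[ i ] I i × C g i x) → ⋃C r I x
    to (i , i∈I , x∈C) = proj₁ x∈C′ , subst I (sym (proj₂ x∈C′)) i∈I
      where
      x∈C′ : x ≢ 0F × relIndex r x ≡ i
      x∈C′ = Equivalence.to (C⇔ (bounded i∈I)) x∈C

    from : ⋃C r I x → ∃[ i ] I i × C g i x
    from (x≢0 , i∈I) = relIndex r x , i∈I , Equivalence.from (C⇔ (bounded i∈I)) (x≢0 , refl)

  D₀⇔ : ∀ x → D₀ g x ⇔ ⋃C r I₀ x
  D₀⇔ x = ⋃C⇔ (λ (_ , i≤11) → s≤s (≤-trans i≤11 (m≤m+n 11 4))) x ⇔-∘ reassociate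
    where
    reassociate : D₀ g x ⇔ (∃[ i ] I₀ i × C g i x)
    reassociate = mk⇔ (λ (i , 4≤i , i≤11 , c) → i , (4≤i , i≤11) , c)
                      (λ (i , (4≤i , i≤11) , c) → i , 4≤i , i≤11 , c)

  D₁⇔ : ∀ x → D₁ g x ⇔ ⋃C r I₁ x
  D₁⇔ = ⋃C⇔ (λ i≤7 → s≤s (≤-trans i≤7 (m≤m+n 7 8)))

-- Skew-symmetry

8*r≡8 : ∀ {r} → r < 16 → Invertible₁₆ r → (8 * r) % 16 ≡ 8
8*r≡8 = from-yes (allUpTo? (λ r → invertible₁₆? r →-dec (8 * r) % 16 ℕ.≟ 8) 16)

infix 3 _⇔?_
_⇔?_ : ∀ {A B : Set} → Dec A → Dec B → Dec (A ⇔ B)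
a? ⇔? b? = map′ (λ (f , g) → mk⇔ f g) (λ A⇔B → Equivalence.to A⇔B , Equivalence.from A⇔B)
                ((a? →-dec b?) ×-dec (b? →-dec a?))

I₀-shift : ∀ {e} → e < 16 → I₀ e ⇔ (¬ I₀ ((8 + e) % 16))
I₀-shift = from-yes (allUpTo? (λ e → I₀? e ⇔? ¬? (I₀? ((8 + e) % 16))) 16)

relIndex-neg : ∀ {r x} → r < 16 → Invertible₁₆ r → x ≢ 0F →
               -F x ≢ 0F × relIndex r (-F x) ≡ (8 + relIndex r x) % 16
relIndex-neg {r} {x} r<16 r-invertible x≢0 = subst (_≢ 0F) (sym (-F≡-1*F x)) (proj₁ -1*x) , %≡% (begin
  ind (-F x) * r      ≈⟨ *-congʳ r (≡%⇒≈ (8 + ind x) ind-neg) ⟩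
  (8 + ind x) * r     ≡⟨ *-distribʳ-+ r 8 (ind x) ⟩
  8 * r + ind x * r   ≈⟨ +-cong (≡%⇒≈ (8 * r) (sym (8*r≡8 r<16 r-invertible))) (m%16≈m (ind x * r)) ⟨
  8 + relIndex r x    ∎)
  where
  open import Relation.Binary.Reasoning.Setoid (Modulo.setoid 16)
  -1*x : -F 1F *F x ≢ 0F × ind (-F 1F *F x) ≡ (8 + ind x) % 16
  -1*x = ind-*F { -F 1F} {x} (λ ()) x≢0
  ind-neg : ind (-F x) ≡ (8 + ind x) % 16
  ind-neg = trans (cong ind (-F≡-1*F x)) (proj₂ -1*x)

⋃C-skew : ∀ {r x} → r < 16 → Invertible₁₆ r → x ≢ 0F → ⋃C r I₀ x ⇔ (¬ ⋃C r I₀ (-F x))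
⋃C-skew {r} {x} r<16 r-invertible x≢0 = mk⇔
  (λ (_ , x∈I₀) (_ , -x∈I₀) → Equivalence.to shift x∈I₀ (subst I₀ (proj₂ neg) -x∈I₀))
  (λ -x∉⋃C → x≢0 , Equivalence.from shift
                     (λ -x∈I₀ → -x∉⋃C (proj₁ neg , subst I₀ (sym (proj₂ neg)) -x∈I₀)))
  where
  neg : -F x ≢ 0F × relIndex r (-F x) ≡ (8 + relIndex r x) % 16
  neg = relIndex-neg r<16 r-invertible x≢0
  shift : I₀ (relIndex r x) ⇔ (¬ I₀ ((8 + relIndex r x) % 16))
  shift = I₀-shift (m%n<n (ind x * r) 16)

-- Autocorrelation

s-cong : ∀ {D E : Pred F 0ℓ} (d : Decidable D) (e : Decidable E) {x y} → D x ⇔ E y → s d x ≡ s e y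
s-cong d e {x} {y} D⇔E = cong (λ b → if b then -[1+ 0 ] else + 1) (does-⇔ D⇔E (d x) (e y))

P-cong : ∀ {D E : Pred F 0ℓ} (d : Decidable D) (e : Decidable E) → (∀ x → D x ⇔ E x) → ∀ w → P d w ≡ P e w
P-cong d e D⇔E w =
  cong sumℤ (map-cong (λ x → cong₂ _*ℤ_ (s-cong d e (D⇔E x)) (s-cong d e (D⇔E (x +F w)))) elements)

sumℤ-↭ : ∀ {xs ys} → xs ↭ ys → sumℤ xs ≡ sumℤ ys
sumℤ-↭ xs↭ys = Permutation.foldr-commMonoid (setoid ℤ) ℤ.+-0-isCommutativeMonoid (↭⇒↭ₛ xs↭ys)

P-invariant : ∀ {D : Pred F 0ℓ} (d : Decidable D) (σ : F → F) → map σ elements ↭ elements →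
              (∀ x y → σ (x +F y) ≡ σ x +F σ y) → (∀ x → D (σ x) ⇔ D x) → ∀ w → P d (σ w) ≡ P d w
P-invariant d σ σ-permutes σ-additive D∘σ⇔D w = begin
  sumℤ (map f elements)              ≡⟨ sumℤ-↭ (map⁺ f σ-permutes) ⟨
  sumℤ (map f (map σ elements))      ≡⟨ cong sumℤ (map-∘ {g = f} {f = σ} elements) ⟨
  sumℤ (map (f ∘ σ) elements)        ≡⟨ cong sumℤ (map-cong f∘σ≗ elements) ⟩
  P d w                              ∎
  where
  open ≡-Reasoning
  f : F → ℤ
  f x = s d x *ℤ s d (x +F σ w)
  f∘σ≗ : ∀ x → f (σ x) ≡ s d x *ℤ s d (x +F w)
  f∘σ≗ x = cong₂ _*ℤ_ (s-cong d d (D∘σ⇔D x))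
                      (trans (cong (s d) (sym (σ-additive x w))) (s-cong d d (D∘σ⇔D (x +F w))))

-- Sorting the image of elements under multiplication by z₀ gives back elements, by evaluation.
*z₀-permutes : map (_*F z₀) elements ↭ elements
*z₀-permutes = subst (map (_*F z₀) elements ↭_) sorted (↭-sym (sort-↭ (map (_*F z₀) elements)))
  where
  lexicographic : DecTotalOrder 0ℓ 0ℓ 0ℓ
  lexicographic = ×-decTotalOrder (≤-decTotalOrder 5)
    (×-decTotalOrder (≤-decTotalOrder 5) (×-decTotalOrder (≤-decTotalOrder 5) (≤-decTotalOrder 5)))
  open SortingAlgorithm (MergeSort.mergeSort lexicographic) using (sort; sort-↭)
  sorted : sort (map (_*F z₀) elements) ≡ elements
  sorted = refl

-- Arguments of P are given explicitly below wherever they are not syntactically determined: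
-- solving for them by unification would unfold the sum over all of F.
P-*^ : ∀ {D : Pred F 0ℓ} (d : Decidable D) z → map (_*F z) elements ↭ elements →
       (∀ x → D (x *F z) ⇔ D x) → ∀ y j → P d (y *F z ^F j) ≡ P d y
P-*^ d z *z-permutes D∘*z⇔D y zero = cong (P d) {y *F z ^F zero} {y} (*F-identityʳ y)
P-*^ d z *z-permutes D∘*z⇔D y (suc j) = begin
  P d (y *F z ^F suc j)      ≡⟨ cong (P d) {y *F z ^F suc j} {(y *F z) *F z ^F j} (sym (*F-assoc y z (z ^F j))) ⟩
  P d ((y *F z) *F z ^F j)   ≡⟨ P-*^ d z *z-permutes D∘*z⇔D (y *F z) j ⟩
  P d (y *F z)               ≡⟨ P-invariant d (_*F z) *z-permutes (λ a b → *F-distribʳ-+F a b z) D∘*z⇔D y ⟩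
  P d y                      ∎
  where open ≡-Reasoning

P-coset : ∀ {D : Pred F 0ℓ} (d : Decidable D) → (∀ x → D (x *F z₀) ⇔ D x) →
          ∀ w → w ≢ 0F → P d w ≡ P d (γ ^F ind w)
P-coset d D∘*z₀⇔D w w≢0 =
  trans (cong (P d) {w} {γ ^F ind w *F z₀ ^F (log w / 16)} (sym (log-coset w w≢0)))
        (P-*^ d z₀ *z₀-permutes D∘*z₀⇔D (γ ^F ind w) (log w / 16))

⋃C-*z₀ : ∀ r I x → ⋃C r I (x *F z₀) ⇔ ⋃C r I x
⋃C-*z₀ r I x = mk⇔
  (λ (xz₀≢0 , i) → ≢0-cancel xz₀≢0 , subst I (relIndex-*z₀ (≢0-cancel xz₀≢0)) i)
  (λ (x≢0 , i) → proj₁ (ind-*F x≢0 z₀≢0) , subst I (sym (relIndex-*z₀ x≢0)) i)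
  where
  z₀≢0 : z₀ ≢ 0F
  z₀≢0 ()
  ≢0-cancel : x *F z₀ ≢ 0F → x ≢ 0F
  ≢0-cancel xz₀≢0 refl = xz₀≢0 refl
  relIndex-*z₀ : x ≢ 0F → relIndex r (x *F z₀) ≡ relIndex r x
  relIndex-*z₀ x≢0 = cong (λ i → (i * r) % 16)
    (trans (proj₂ (ind-*F x≢0 z₀≢0)) (trans (cong (_% 16) (+-identityʳ (ind x))) (m%n%n≡m%n (log x) 16)))

autocorrelation-γ^ : ∀ r → r < 16 → Invertible₁₆ r → ∀ i → i < 16 →
                     P (⋃C? r I₀?) (γ ^F i) +ℤ P (⋃C? r I₁?) (γ ^F i) ≡ -[1+ 1 ]
autocorrelation-γ^ r r<16 r-invertible i i<16 = checked {r} r<16 r-invertible {i} i<16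
  where
  checked : ∀ {r} → r < 16 → Invertible₁₆ r → ∀ {i} → i < 16 →
            P (⋃C? r I₀?) (γ ^F i) +ℤ P (⋃C? r I₁?) (γ ^F i) ≡ -[1+ 1 ]
  checked = from-yes (allUpTo? (λ r → invertible₁₆? r →-dec
    allUpTo? (λ i → P (⋃C? r I₀?) (γ ^F i) +ℤ P (⋃C? r I₁?) (γ ^F i) ℤ.≟ -[1+ 1 ]) 16) 16)

autocorrelation-coset : ∀ r w → w ≢ 0F →
                        P (⋃C? r I₀?) w +ℤ P (⋃C? r I₁?) w
                        ≡ P (⋃C? r I₀?) (γ ^F ind w) +ℤ P (⋃C? r I₁?) (γ ^F ind w)
autocorrelation-coset r w w≢0 = cong₂ _+ℤ_
  (P-coset {⋃C r I₀} (⋃C? r I₀?) (⋃C-*z₀ r I₀) w w≢0)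
  (P-coset {⋃C r I₁} (⋃C? r I₁?) (⋃C-*z₀ r I₁) w w≢0)

⋃C-autocorrelation : ∀ r w → r < 16 → Invertible₁₆ r → w ≢ 0F →
                     P (⋃C? r I₀?) w +ℤ P (⋃C? r I₁?) w ≡ -[1+ 1 ]
⋃C-autocorrelation r w r<16 r-invertible w≢0 =
  trans (autocorrelation-coset r w w≢0) (autocorrelation-γ^ r r<16 r-invertible (ind w) (m%n<n (log w) 16))

proposition3p1 : (g : F) → IsPrimitive g →
    ((x : F) → ¬ (x ≡ 0F) → (D₀ g x ⇔ (¬ D₀ g (-F x))))
    × ((d₀ : Decidable (D₀ g)) → (d₁ : Decidable (D₁ g)) →
    (w : F) → ¬ (w ≡ 0F) → P d₀ w +ℤ P d₁ w ≡ -[1+ 1 ])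
proposition3p1 g prim = skew , autocorrelation
  where
  open Primitive prim
  open Equivalence

  skew : (x : F) → ¬ (x ≡ 0F) → D₀ g x ⇔ (¬ D₀ g (-F x))
  skew x x≢0 = mk⇔
    (λ x∈D₀ -x∈D₀ → to (⋃C-skew r<16 r-invertible x≢0) (to (D₀⇔ x) x∈D₀) (to (D₀⇔ (-F x)) -x∈D₀))
    (λ -x∉D₀ → from (D₀⇔ x) (from (⋃C-skew r<16 r-invertible x≢0)
                                  (λ -x∈⋃C → -x∉D₀ (from (D₀⇔ (-F x)) -x∈⋃C))))

  autocorrelation : (d₀ : Decidable (D₀ g)) → (d₁ : Decidable (D₁ g)) →
                    (w : F) → ¬ (w ≡ 0F) → P d₀ w +ℤ P d₁ w ≡ -[1+ 1 ]
  autocorrelation d₀ d₁ w w≢0 = begin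
    P d₀ w +ℤ P d₁ w
      ≡⟨ cong₂ _+ℤ_ (P-cong {D₀ g} {⋃C r I₀} d₀ (⋃C? r I₀?) D₀⇔ w)
                    (P-cong {D₁ g} {⋃C r I₁} d₁ (⋃C? r I₁?) D₁⇔ w) ⟩
    P (⋃C? r I₀?) w +ℤ P (⋃C? r I₁?) w
      ≡⟨ ⋃C-autocorrelation r w r<16 r-invertible w≢0 ⟩
    -[1+ 1 ]
      ∎
    where open ≡-Reasoning
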